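{- Let $k$ be a field and $m,n\geq1$, $N=mn$. For $\underline{v}\in k^{N-1}$ write $(1,\underline{v})=(a_1,\dots,a_m)$ with $a_i\in k^n$ (row vectors) and let $R(\underline{v})\in M_{m,n}(k)$ be the matrix with rows $a_1,\dots,a_m$; conversely, for $R\in M_{m,n}(k)$ with $(1,1)$-entry equal to $1$, write $u_1(R)=\begin{pmatrix}1&\underline{v}\\0&I_{N-1}\end{pmatrix}$ where $(1,\underline{v})$ is the concatenation of the rows of $R$. Let $w_1=\begin{pmatrix}0&I_{N-1}\\1&0\end{pmatrix}$. Then for all $h\in\mathrm{H}_{1,m-1}(k)$, $g\in\mathrm{H}_{1,n-1}(k)$ and $\underline{v}\in k^{N-1}$, $$P_{N-1,1}(k)\,w_1\,u_1(R(\underline{v}))\,t(h,g)=P_{N-1,1}(k)\,w_1\,u_1\big(h^TR(\underline{v})g\big).$$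
   Context: $P_{N-1,1}(k)$ is the group of matrices $\begin{pmatrix}A&X\\0&d\end{pmatrix}$, $A\in\mathrm{GL}_{N-1}(k)$, $d\in k^\times$. $\mathrm{H}_{1,r}(k)$ is the subgroup of $\mathrm{GL}_{1+r}(k)$ of matrices $\begin{pmatrix}1&x\\0&h'\end{pmatrix}$ with $h'\in\mathrm{GL}_r(k)$, $x\in k^r$. $t(h,g)$ is the Kronecker product of $h=(h_{ij})\in\mathrm{GL}_m$ and $g\in\mathrm{GL}_n$: the block matrix whose $(i,j)$ block is $h_{ij}g$. (Note $h^TR(\underline{v})g$ again has $(1,1)$-entry $1$.) -}

module Defs where

open import Level using (Level; _⊔_)
open import Algebra.Bundles using (CommutativeRing)
open import Data.Nat as ℕ using (ℕ; zero; suc)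
open import Data.Fin as Fin using (Fin; zero; suc; toℕ; inject₁; fromℕ; combine; quotient; remainder)
open import Data.Product using (Σ; ∃; _×_; _,_)
open import Relation.Nullary using (¬_; yes; no)
open import Relation.Binary.PropositionalEquality using (_≡_)
open import Function.Bundles using (_⇔_)

-- A field: a commutative ring with 0 ≉ 1 in which every nonzero element
-- has a multiplicative inverse (agda-stdlib has no plain Field bundle).
record Field (c ℓ : Level) : Set (Level.suc (c ⊔ ℓ)) where
  field
    commutativeRing : CommutativeRing c ℓ
  open CommutativeRing commutativeRing public
  field
    0≉1     : ¬ (0# ≈ 1#)
    inverse : ∀ x → ¬ (x ≈ 0#) → ∃ λ y → (x * y) ≈ 1#

module _ {c ℓ : Level} (F : Field c ℓ) where
  open Field F using (Carrier; _≈_; _+_; _*_; 0#; 1#)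

  K : Set c
  K = Carrier

  Mat : ℕ → ℕ → Set c
  Mat m n = Fin m → Fin n → K

  _≈M_ : ∀ {m n} → Mat m n → Mat m n → Set ℓ
  A ≈M B = ∀ i j → A i j ≈ B i j

  Σ[_] : ∀ n → (Fin n → K) → K
  Σ[ zero ] f = 0#
  Σ[ suc n ] f = f zero + Σ[ n ] (λ i → f (suc i))

  _·_ : ∀ {m n p} → Mat m n → Mat n p → Mat m p
  _·_ {n = n} A B i j = Σ[ n ] (λ l → A i l * B l j)

  I : ∀ n → Mat n n
  I n i j with toℕ i ℕ.≟ toℕ j
  ... | yes _ = 1#
  ... | no _  = 0#

  transpose : ∀ {m n} → Mat m n → Mat n m
  transpose A i j = A j i

  InGL : ∀ n → Mat n n → Set (c ⊔ ℓ)
  InGL n A = Σ (Mat n n) λ B → ((A · B) ≈M I n) × ((B · A) ≈M I n)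

  -- P_{N-1,1}(k) ⊆ GL_N(k), N = suc N': matrices (A X; 0 d), A ∈ GL_{N-1}, d ∈ k^×
  InP : ∀ N' → Mat (suc N') (suc N') → Set (c ⊔ ℓ)
  InP N' M =
      (∀ j → M (fromℕ N') (inject₁ j) ≈ 0#)
    × InGL N' (λ i j → M (inject₁ i) (inject₁ j))
    × ¬ (M (fromℕ N') (fromℕ N') ≈ 0#)

  -- H_{1,r}(k): matrices (1 x; 0 h') with h' ∈ GL_r(k)
  InH : ∀ r → Mat (suc r) (suc r) → Set (c ⊔ ℓ)
  InH r h =
      (h zero zero ≈ 1#)
    × (∀ i → h (suc i) zero ≈ 0#)
    × InGL r (λ i j → h (suc i) (suc j))

  -- Kronecker product t(h,g): block (i,j) equals h_ij g,
  -- row index combine i k = i*n + k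
  t : ∀ {m n} → Mat m m → Mat n n → Mat (m ℕ.* n) (m ℕ.* n)
  t {m} {n} h g a b =
    h (quotient n a) (quotient n b) * g (remainder {m} n a) (remainder {m} n b)

  one∷ : ∀ {N'} → (Fin N' → K) → Fin (suc N') → K
  one∷ v zero = 1#
  one∷ v (suc i) = v i

  -- R(v) ∈ M_{m,n}(k) for m = suc m', n = suc n', N = m n = suc (n' + m' * suc n'):
  -- rows a_1..a_m where (1,v) = (a_1,...,a_m)
  R : ∀ m' n' → (Fin (n' ℕ.+ m' ℕ.* suc n') → K) → Mat (suc m') (suc n')
  R m' n' v i j = one∷ v (combine i j)

  -- u_1(R) = (1 v; 0 I_{N-1}) where (1,v) is the concatenation of the rows of R
  -- (R is only applied to matrices whose (1,1)-entry is 1)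
  u₁ : ∀ m' n' → Mat (suc m') (suc n') → Mat (suc m' ℕ.* suc n') (suc m' ℕ.* suc n')
  u₁ m' n' Rm zero zero = 1#
  u₁ m' n' Rm zero (suc j) =
    Rm (quotient (suc n') (suc j)) (remainder {suc m'} (suc n') (suc j))
  u₁ m' n' Rm (suc i) zero = 0#
  u₁ m' n' Rm (suc i) (suc j) = I (n' ℕ.+ m' ℕ.* suc n') i j

  -- w_1 = (0 I_{N-1}; 1 0), N = suc N'
  w₁ : ∀ N' → Mat (suc N') (suc N')
  w₁ N' i j with toℕ j ℕ.≟ suc (toℕ i) | toℕ i ℕ.≟ N' | toℕ j ℕ.≟ 0
  ... | yes _ | _     | _     = 1#
  ... | no _  | yes _ | yes _ = 1#
  ... | no _  | _     | _     = 0#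

  InPCoset : ∀ N' → Mat (suc N') (suc N') → Mat (suc N') (suc N') → Set (c ⊔ ℓ)
  InPCoset N' x z = Σ (Mat (suc N') (suc N')) λ p → InP N' p × (z ≈M (p · x))

  SameCoset : ∀ N' → Mat (suc N') (suc N') → Mat (suc N') (suc N') → Set (c ⊔ ℓ)
  SameCoset N' x y = ∀ z → InPCoset N' x z ⇔ InPCoset N' y z

-- Since h and g have first column e₁, so does t = t(h,g), and then
--   u₁(R) t = diag(1, A) u₁(hᵀ R g),   A = lower-right (N-1)×(N-1) block of t,
-- because the first row of u₁(R) t is vec(R)(h ⊗ g) = vec(hᵀ R g) and the other rows are those of t.
-- The block A is invertible (t(h,g)⁻¹ = t(h⁻¹,g⁻¹) also has first column e₁), and conjugating diag(1, A)
-- by w₁ gives diag(A, 1) ∈ P_{N-1,1}, so both cosets agree.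
module Submission where

open import Defs
open import Level using (Level)
open import Data.Nat as ℕ using (ℕ; zero; suc)
open import Data.Nat.Properties using (<⇒≢)
open import Data.Fin using (Fin; zero; suc; toℕ; inject₁; fromℕ; combine; quotient; remainder; _↑ˡ_; _↑ʳ_)
open import Data.Fin.Properties
  using ( toℕ-injective; toℕ-inject₁; toℕ-inject₁-≢; toℕ-fromℕ; toℕ<n; suc-injective
        ; remQuot-combine; combine-remQuot)
  renaming (_≟_ to _≟ᶠ_)
open import Data.Product using (Σ-syntax; ∃; _×_; _,_; proj₁; proj₂)
open import Data.Sum using (_⊎_; inj₁; inj₂)
open import Function using (_∘_)
open import Function.Bundles using (mk⇔)
open import Relation.Nullary using (¬_; yes; no; contradiction)
open import Relation.Binary.PropositionalEquality as ≡ using (_≡_; _≢_)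
import Algebra.Properties.CommutativeSemigroup as CommutativeSemigroupProperties
import Algebra.Properties.Ring as RingProperties
import Relation.Binary.Reasoning.Setoid as SetoidReasoning

-- rotate n i = i + 1 modulo n + 1; the permutation matrix w₁ moves row rotate i to row i.
rotate : ∀ n → Fin (suc n) → Fin (suc n)
rotate zero    zero    = zero
rotate (suc n) zero    = suc zero
rotate (suc n) (suc i) = shift (rotate n i)
  where
  shift : Fin (suc n) → Fin (suc (suc n))
  shift zero    = zero
  shift (suc k) = suc (suc k)

rotate-inject₁ : ∀ n (j : Fin n) → rotate n (inject₁ j) ≡ suc j
rotate-inject₁ (suc n) zero    = ≡.refl
rotate-inject₁ (suc n) (suc j) rewrite rotate-inject₁ n j = ≡.refl

rotate-fromℕ : ∀ n → rotate n (fromℕ n) ≡ zero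
rotate-fromℕ zero    = ≡.refl
rotate-fromℕ (suc n) rewrite rotate-fromℕ n = ≡.refl

inject₁-or-fromℕ : ∀ n (i : Fin (suc n)) → (∃ λ j → i ≡ inject₁ j) ⊎ i ≡ fromℕ n
inject₁-or-fromℕ zero    zero    = inj₂ ≡.refl
inject₁-or-fromℕ (suc n) zero    = inj₁ (zero , ≡.refl)
inject₁-or-fromℕ (suc n) (suc i) with inject₁-or-fromℕ n i
... | inj₁ (j , ≡.refl) = inj₁ (suc j , ≡.refl)
... | inj₂ ≡.refl       = inj₂ ≡.refl

module _ {c ℓ : Level} (F : Field c ℓ) where
  open Field F hiding (zero)
  open SetoidReasoning setoid

  ∑ : ∀ n → (Fin n → K F) → K F
  ∑ = Σ[_] F

  infix  4 _≈ᴹ_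
  infixl 7 _·ᴹ_ _ᵥ·ᴹ_

  _≈ᴹ_ : ∀ {m n} → Mat F m n → Mat F m n → Set ℓ
  _≈ᴹ_ = _≈M_ F

  _·ᴹ_ : ∀ {m n p} → Mat F m n → Mat F n p → Mat F m p
  _·ᴹ_ = _·_ F

  _ᵥ·ᴹ_ : ∀ {m n} → (Fin m → K F) → Mat F m n → Fin n → K F
  _ᵥ·ᴹ_ {m} w M j = ∑ m (λ l → w l * M l j)

  Σ-cong : ∀ n {f g : Fin n → K F} → (∀ i → f i ≈ g i) → ∑ n f ≈ ∑ n g
  Σ-cong zero    f≈g = refl
  Σ-cong (suc n) f≈g = +-cong (f≈g zero) (Σ-cong n (λ i → f≈g (suc i)))

  Σ-zero : ∀ n {f : Fin n → K F} → (∀ i → f i ≈ 0#) → ∑ n f ≈ 0#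
  Σ-zero zero    f≈0 = refl
  Σ-zero (suc n) f≈0 = trans (+-cong (f≈0 zero) (Σ-zero n (λ i → f≈0 (suc i)))) (+-identityˡ 0#)

  Σ-distrib-+ : ∀ n (f g : Fin n → K F) → ∑ n (λ i → f i + g i) ≈ ∑ n f + ∑ n g
  Σ-distrib-+ zero    f g = sym (+-identityˡ 0#)
  Σ-distrib-+ (suc n) f g =
    trans (+-congˡ (Σ-distrib-+ n _ _)) (CommutativeSemigroupProperties.interchange +-commutativeSemigroup _ _ _ _)

  *-distribˡ-Σ : ∀ n a (f : Fin n → K F) → a * ∑ n f ≈ ∑ n (λ i → a * f i)
  *-distribˡ-Σ zero    a f = zeroʳ a
  *-distribˡ-Σ (suc n) a f = trans (distribˡ a _ _) (+-congˡ (*-distribˡ-Σ n a _))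

  *-distribʳ-Σ : ∀ n a (f : Fin n → K F) → ∑ n f * a ≈ ∑ n (λ i → f i * a)
  *-distribʳ-Σ zero    a f = zeroˡ a
  *-distribʳ-Σ (suc n) a f = trans (distribʳ a _ _) (+-congˡ (*-distribʳ-Σ n a _))

  -‿distrib-Σ : ∀ n (f : Fin n → K F) → ∑ n (λ i → - f i) ≈ - ∑ n f
  -‿distrib-Σ zero    f = sym (RingProperties.-0#≈0# ring)
  -‿distrib-Σ (suc n) f = trans (+-congˡ (-‿distrib-Σ n _)) (RingProperties.-‿+-comm ring _ _)

  Σ-comm : ∀ m n (f : Fin m → Fin n → K F) → ∑ m (λ i → ∑ n (f i)) ≈ ∑ n (λ j → ∑ m (λ i → f i j))
  Σ-comm zero    n f = sym (Σ-zero n (λ _ → refl))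
  Σ-comm (suc m) n f = trans (+-congˡ (Σ-comm m n _)) (sym (Σ-distrib-+ n _ _))

  Σ-init-last : ∀ n (f : Fin (suc n) → K F) → ∑ (suc n) f ≈ ∑ n (λ i → f (inject₁ i)) + f (fromℕ n)
  Σ-init-last zero    f = +-comm _ _
  Σ-init-last (suc n) f = trans (+-congˡ (Σ-init-last n (λ i → f (suc i)))) (sym (+-assoc _ _ _))

  Σ-select : ∀ n (k : Fin n) (f : Fin n → K F) → (∀ l → l ≢ k → f l ≈ 0#) → ∑ n f ≈ f k
  Σ-select (suc n) zero    f f≈0 = trans (+-congˡ (Σ-zero n (λ i → f≈0 (suc i) λ ()))) (+-identityʳ _)
  Σ-select (suc n) (suc k) f f≈0 =
    trans (+-cong (f≈0 zero λ ()) (Σ-select n k _ (λ l l≢k → f≈0 (suc l) (l≢k ∘ suc-injective)))) (+-identityˡ _)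

  Σ-splitAt : ∀ m n (f : Fin (m ℕ.+ n) → K F) →
    ∑ (m ℕ.+ n) f ≈ ∑ m (λ i → f (i ↑ˡ n)) + ∑ n (λ j → f (m ↑ʳ j))
  Σ-splitAt zero    n f = sym (+-identityˡ _)
  Σ-splitAt (suc m) n f = trans (+-congˡ (Σ-splitAt m n _)) (sym (+-assoc _ _ _))

  Σ-combine : ∀ m n (f : Fin (m ℕ.* n) → K F) → ∑ (m ℕ.* n) f ≈ ∑ m (λ i → ∑ n (λ j → f (combine i j)))
  Σ-combine zero    n f = refl
  Σ-combine (suc m) n f = trans (Σ-splitAt n (m ℕ.* n) f) (+-congˡ (Σ-combine m n _))

  Σ-remQuot : ∀ m n (f : Fin m → Fin n → K F) →
    ∑ (m ℕ.* n) (λ l → f (quotient n l) (remainder {m} n l)) ≈ ∑ m (λ i → ∑ n (f i))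
  Σ-remQuot m n f = trans (Σ-combine m n _) (Σ-cong m λ i → Σ-cong n λ j →
    reflexive (≡.cong₂ f (≡.cong proj₁ (remQuot-combine i j)) (≡.cong proj₂ (remQuot-combine i j))))

  Σ-rotate : ∀ n (f : Fin (suc n) → K F) → ∑ (suc n) (λ l → f (rotate n l)) ≈ ∑ (suc n) f
  Σ-rotate n f = begin
    ∑ (suc n) (λ l → f (rotate n l))                               ≈⟨ Σ-init-last n (λ l → f (rotate n l)) ⟩
    ∑ n (λ i → f (rotate n (inject₁ i))) + f (rotate n (fromℕ n))
      ≈⟨ +-cong (Σ-cong n λ i → reflexive (≡.cong f (rotate-inject₁ n i))) (reflexive (≡.cong f (rotate-fromℕ n))) ⟩
    ∑ n (λ i → f (suc i)) + f zero                                  ≈⟨ +-comm _ _ ⟩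
    ∑ (suc n) f                                                     ∎

  ≈ᴹ-sym : ∀ {m n} {A B : Mat F m n} → A ≈ᴹ B → B ≈ᴹ A
  ≈ᴹ-sym A≈B i j = sym (A≈B i j)

  ≈ᴹ-trans : ∀ {m n} {A B C : Mat F m n} → A ≈ᴹ B → B ≈ᴹ C → A ≈ᴹ C
  ≈ᴹ-trans A≈B B≈C i j = trans (A≈B i j) (B≈C i j)

  ·ᴹ-congˡ : ∀ {m n p} (A : Mat F m n) {B B′ : Mat F n p} → B ≈ᴹ B′ → A ·ᴹ B ≈ᴹ A ·ᴹ B′
  ·ᴹ-congˡ {n = n} A B≈B′ i j = Σ-cong n λ l → *-congˡ (B≈B′ l j)

  ·ᴹ-congʳ : ∀ {m n p} (B : Mat F n p) {A A′ : Mat F m n} → A ≈ᴹ A′ → A ·ᴹ B ≈ᴹ A′ ·ᴹ B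
  ·ᴹ-congʳ {n = n} B A≈A′ i j = Σ-cong n λ l → *-congʳ (A≈A′ i l)

  ·ᴹ-assoc : ∀ {m n p q} (A : Mat F m n) (B : Mat F n p) (C : Mat F p q) → A ·ᴹ B ·ᴹ C ≈ᴹ A ·ᴹ (B ·ᴹ C)
  ·ᴹ-assoc {n = n} {p} A B C i j = begin
    ∑ p (λ l → ∑ n (λ k → A i k * B k l) * C l j)   ≈⟨ Σ-cong p (λ l → *-distribʳ-Σ n (C l j) _) ⟩
    ∑ p (λ l → ∑ n (λ k → A i k * B k l * C l j))   ≈⟨ Σ-comm n p _ ⟨
    ∑ n (λ k → ∑ p (λ l → A i k * B k l * C l j))   ≈⟨ Σ-cong n (λ k → Σ-cong p λ l → *-assoc _ _ _) ⟩
    ∑ n (λ k → ∑ p (λ l → A i k * (B k l * C l j))) ≈⟨ Σ-cong n (λ k → *-distribˡ-Σ p (A i k) _) ⟨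
    ∑ n (λ k → A i k * ∑ p (λ l → B k l * C l j))   ∎

  I-diag : ∀ n (i : Fin n) {j} → i ≡ j → I F n i j ≡ 1#
  I-diag n i {j} i≡j with toℕ i ℕ.≟ toℕ j
  ... | yes _   = ≡.refl
  ... | no i≢j  = contradiction (≡.cong toℕ i≡j) i≢j

  I-offdiag : ∀ n {i j : Fin n} → i ≢ j → I F n i j ≡ 0#
  I-offdiag n {i} {j} i≢j with toℕ i ℕ.≟ toℕ j
  ... | yes i≡j = contradiction (toℕ-injective i≡j) i≢j
  ... | no _    = ≡.refl

  ·ᴹ-identityˡ : ∀ {m n} (A : Mat F m n) → I F m ·ᴹ A ≈ᴹ A
  ·ᴹ-identityˡ {m} A i j = trans
    (Σ-select m i _ λ l l≢i → trans (*-congʳ (reflexive (I-offdiag m (l≢i ∘ ≡.sym)))) (zeroˡ _))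
    (trans (*-congʳ (reflexive (I-diag m i ≡.refl))) (*-identityˡ _))

  ·ᴹ-identityʳ : ∀ {m n} (A : Mat F m n) → A ·ᴹ I F n ≈ᴹ A
  ·ᴹ-identityʳ {n = n} A i j = trans
    (Σ-select n j _ λ l l≢j → trans (*-congˡ (reflexive (I-offdiag n l≢j))) (zeroʳ _))
    (trans (*-congˡ (reflexive (I-diag n j ≡.refl))) (*-identityʳ _))

  InGL-resp : ∀ n {A} (A′ : Mat F n n) → A ≈ᴹ A′ → InGL F n A′ → InGL F n A
  InGL-resp n A′ A≈A′ (B , A′B≈I , BA′≈I) =
    B , ≈ᴹ-trans (·ᴹ-congʳ B A≈A′) A′B≈I , ≈ᴹ-trans (·ᴹ-congˡ B A≈A′) BA′≈I

  InGL-·ᴹ : ∀ n (A A′ : Mat F n n) → InGL F n A → InGL F n A′ → InGL F n (A ·ᴹ A′)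
  InGL-·ᴹ n A A′ (B , AB≈I , BA≈I) (B′ , A′B′≈I , B′A′≈I) =
    B′ ·ᴹ B , cancel A A′ B′ B A′B′≈I AB≈I , cancel B′ B A A′ BA≈I B′A′≈I
    where
    cancel : ∀ (X Y Z W : Mat F n n) → Y ·ᴹ Z ≈ᴹ I F n → X ·ᴹ W ≈ᴹ I F n →
      X ·ᴹ Y ·ᴹ (Z ·ᴹ W) ≈ᴹ I F n
    cancel X Y Z W YZ≈I XW≈I =
      ≈ᴹ-trans (·ᴹ-assoc X Y _) (≈ᴹ-trans (·ᴹ-congˡ X (≈ᴹ-sym (·ᴹ-assoc Y Z W)))
      (≈ᴹ-trans (·ᴹ-congˡ X (·ᴹ-congʳ W YZ≈I)) (≈ᴹ-trans (·ᴹ-congˡ X (·ᴹ-identityˡ W)) XW≈I)))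

  *-nonzero : ∀ {a b} → ¬ (a ≈ 0#) → ¬ (b ≈ 0#) → ¬ (a * b ≈ 0#)
  *-nonzero {a} {b} a≉0 b≉0 ab≈0 with inverse b b≉0
  ... | b⁻¹ , bb⁻¹≈1 = a≉0 (begin
    a              ≈⟨ *-identityʳ a ⟨
    a * 1#         ≈⟨ *-congˡ bb⁻¹≈1 ⟨
    a * (b * b⁻¹)  ≈⟨ *-assoc a b b⁻¹ ⟨
    a * b * b⁻¹    ≈⟨ *-congʳ ab≈0 ⟩
    0# * b⁻¹       ≈⟨ zeroˡ b⁻¹ ⟩
    0#             ∎)

  -- The parabolic subgroup P_{N-1,1}

  upperLeft : ∀ {n} → Mat F (suc n) (suc n) → Mat F n n
  upperLeft M i j = M (inject₁ i) (inject₁ j)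

  LastRowZero : ∀ {n} → Mat F (suc n) (suc n) → Set ℓ
  LastRowZero {n} M = ∀ j → M (fromℕ n) (inject₁ j) ≈ 0#

  upperLeft-·ᴹ : ∀ {n} (M M′ : Mat F (suc n) (suc n)) → LastRowZero M′ →
    upperLeft (M ·ᴹ M′) ≈ᴹ upperLeft M ·ᴹ upperLeft M′
  upperLeft-·ᴹ {n} M M′ M′₀ i j =
    trans (Σ-init-last n (λ l → M (inject₁ i) l * M′ l (inject₁ j)))
          (trans (+-congˡ (trans (*-congˡ (M′₀ j)) (zeroʳ _))) (+-identityʳ _))

  lastRow-·ᴹ : ∀ {n} (M M′ : Mat F (suc n) (suc n)) → LastRowZero M →
    ∀ j → (M ·ᴹ M′) (fromℕ n) j ≈ M (fromℕ n) (fromℕ n) * M′ (fromℕ n) j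
  lastRow-·ᴹ {n} M M′ M₀ j = trans (Σ-init-last n (λ l → M (fromℕ n) l * M′ l j))
    (trans (+-congʳ (Σ-zero n λ l → trans (*-congʳ (M₀ l)) (zeroˡ _))) (+-identityˡ _))

  InP-·ᴹ : ∀ N′ (M M′ : Mat F (suc N′) (suc N′)) → InP F N′ M → InP F N′ M′ → InP F N′ (M ·ᴹ M′)
  InP-·ᴹ N′ M M′ (M₀ , M-GL , M≉0) (M′₀ , M′-GL , M′≉0) =
    (λ j → trans (lastRow-·ᴹ M M′ M₀ _) (trans (*-congˡ (M′₀ j)) (zeroʳ _))) ,
    InGL-resp N′ (upperLeft M ·ᴹ upperLeft M′) (upperLeft-·ᴹ M M′ M′₀) (InGL-·ᴹ N′ _ _ M-GL M′-GL) ,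
    (λ MM′≈0 → *-nonzero M≉0 M′≉0 (trans (sym (lastRow-·ᴹ M M′ M₀ _)) MM′≈0))

  sameCoset : ∀ N′ {x y : Mat F (suc N′) (suc N′)} (p q : Mat F (suc N′) (suc N′)) → InP F N′ p → InP F N′ q →
    x ≈ᴹ p ·ᴹ y → y ≈ᴹ q ·ᴹ x → SameCoset F N′ x y
  sameCoset N′ {x} {y} p q p∈P q∈P x≈py y≈qx z = mk⇔
    (λ (r , r∈P , z≈rx) → r ·ᴹ p , InP-·ᴹ N′ r p r∈P p∈P ,
      ≈ᴹ-trans z≈rx (≈ᴹ-trans (·ᴹ-congˡ r x≈py) (≈ᴹ-sym (·ᴹ-assoc r p y))))
    (λ (r , r∈P , z≈ry) → r ·ᴹ q , InP-·ᴹ N′ r q r∈P q∈P ,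
      ≈ᴹ-trans z≈ry (≈ᴹ-trans (·ᴹ-congˡ r y≈qx) (≈ᴹ-sym (·ᴹ-assoc r q x))))

  -- Matrices with first column e₁: H_{1,r}, u₁ and diag(1, A)

  lowerRight : ∀ {m n} → Mat F (suc m) (suc n) → Mat F m n
  lowerRight M i j = M (suc i) (suc j)

  ZeroBelowCorner : ∀ {m n} → Mat F (suc m) (suc n) → Set ℓ
  ZeroBelowCorner M = ∀ i → M (suc i) zero ≈ 0#

  1⊕_ : ∀ {n} → Mat F n n → Mat F (suc n) (suc n)
  (1⊕ A) zero    zero    = 1#
  (1⊕ A) zero    (suc j) = 0#
  (1⊕ A) (suc i) zero    = 0#
  (1⊕ A) (suc i) (suc j) = A i j

  withFirstRow : ∀ {n} → (Fin (suc n) → K F) → Mat F (suc n) (suc n)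
  withFirstRow w zero    j       = w j
  withFirstRow w (suc i) zero    = 0#
  withFirstRow {n} w (suc i) (suc j) = I F n i j

  lowerRight-I : ∀ n → lowerRight (I F (suc n)) ≈ᴹ I F n
  lowerRight-I n i j with i ≟ᶠ j
  ... | yes ≡.refl = reflexive (≡.trans (I-diag (suc n) (suc i) ≡.refl) (≡.sym (I-diag n i ≡.refl)))
  ... | no i≢j     = reflexive (≡.trans (I-offdiag (suc n) (i≢j ∘ suc-injective)) (≡.sym (I-offdiag n i≢j)))

  ·ᴹ-column₀ : ∀ {m n} (M : Mat F m (suc n)) (M′ : Mat F (suc n) (suc n)) → ZeroBelowCorner M′ →
    ∀ i → (M ·ᴹ M′) i zero ≈ M i zero * M′ zero zero
  ·ᴹ-column₀ {n = n} M M′ M′₀ i =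
    trans (+-congˡ (Σ-zero n λ l → trans (*-congˡ (M′₀ l)) (zeroʳ _))) (+-identityʳ _)

  ZeroBelowCorner-·ᴹ : ∀ {n} (M M′ : Mat F (suc n) (suc n)) →
    ZeroBelowCorner M → ZeroBelowCorner M′ → ZeroBelowCorner (M ·ᴹ M′)
  ZeroBelowCorner-·ᴹ M M′ M₀ M′₀ i = trans (·ᴹ-column₀ M M′ M′₀ (suc i)) (trans (*-congʳ (M₀ i)) (zeroˡ _))

  lowerRight-·ᴹ : ∀ {n} (M M′ : Mat F (suc n) (suc n)) → ZeroBelowCorner M →
    lowerRight (M ·ᴹ M′) ≈ᴹ lowerRight M ·ᴹ lowerRight M′
  lowerRight-·ᴹ M M′ M₀ i j = trans (+-congʳ (trans (*-congʳ (M₀ i)) (zeroˡ _))) (+-identityˡ _)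

  ≈I-byBlocks : ∀ {n} (M : Mat F (suc n) (suc n)) → M zero zero ≈ 1# → (∀ j → M zero (suc j) ≈ 0#) →
    ZeroBelowCorner M → lowerRight M ≈ᴹ I F n → M ≈ᴹ I F (suc n)
  ≈I-byBlocks M M₀₀ M₀ⱼ Mᵢ₀ Mᵢⱼ zero    zero    = M₀₀
  ≈I-byBlocks M M₀₀ M₀ⱼ Mᵢ₀ Mᵢⱼ zero    (suc j) = M₀ⱼ j
  ≈I-byBlocks M M₀₀ M₀ⱼ Mᵢ₀ Mᵢⱼ (suc i) zero    = Mᵢ₀ i
  ≈I-byBlocks {n} M M₀₀ M₀ⱼ Mᵢ₀ Mᵢⱼ (suc i) (suc j) = trans (Mᵢⱼ i j) (sym (lowerRight-I n i j))

  InGL-lowerRight : ∀ n (M M′ : Mat F (suc n) (suc n)) → ZeroBelowCorner M → ZeroBelowCorner M′ →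
    M ·ᴹ M′ ≈ᴹ I F (suc n) → M′ ·ᴹ M ≈ᴹ I F (suc n) → InGL F n (lowerRight M)
  InGL-lowerRight n M M′ M₀ M′₀ MM′≈I M′M≈I =
    lowerRight M′ , inverse-block M M′ M₀ MM′≈I , inverse-block M′ M M′₀ M′M≈I
    where
    inverse-block : ∀ (X Y : Mat F (suc n) (suc n)) → ZeroBelowCorner X → X ·ᴹ Y ≈ᴹ I F (suc n) →
      lowerRight X ·ᴹ lowerRight Y ≈ᴹ I F n
    inverse-block X Y X₀ XY≈I i j =
      trans (sym (lowerRight-·ᴹ X Y X₀ i j)) (trans (XY≈I (suc i) (suc j)) (lowerRight-I n i j))

  1⊕-·ᴹ-first : ∀ {n p} (A : Mat F n n) (Z : Mat F (suc n) p) → ∀ j → (1⊕ A ·ᴹ Z) zero j ≈ Z zero j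
  1⊕-·ᴹ-first {n} A Z j = trans (+-cong (*-identityˡ _) (Σ-zero n λ l → zeroˡ _)) (+-identityʳ _)

  1⊕-·ᴹ-rest : ∀ {n p} (A : Mat F n n) (Z : Mat F (suc n) p) →
    ∀ i j → (1⊕ A ·ᴹ Z) (suc i) j ≈ (A ·ᴹ (λ l → Z (suc l))) i j
  1⊕-·ᴹ-rest A Z i j = trans (+-congʳ (zeroˡ _)) (+-identityˡ _)

  1⊕-inverse : ∀ n {A B : Mat F n n} → B ·ᴹ A ≈ᴹ I F n → 1⊕ B ·ᴹ 1⊕ A ≈ᴹ I F (suc n)
  1⊕-inverse n {A} {B} BA≈I = ≈I-byBlocks (1⊕ B ·ᴹ 1⊕ A)
    (trans (·ᴹ-column₀ (1⊕ B) (1⊕ A) (λ _ → refl) zero) (*-identityˡ 1#))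
    (1⊕-·ᴹ-first B (1⊕ A) ∘ suc)
    (ZeroBelowCorner-·ᴹ (1⊕ B) (1⊕ A) (λ _ → refl) (λ _ → refl))
    (≈ᴹ-trans (lowerRight-·ᴹ (1⊕ B) (1⊕ A) (λ _ → refl)) BA≈I)

  -- Row 0 of both sides is w T; below it the left side has the rows of T, whose first entries vanish.
  withFirstRow-·ᴹ : ∀ {n} (w : Fin (suc n) → K F) (T : Mat F (suc n) (suc n)) → ZeroBelowCorner T →
    withFirstRow w ·ᴹ T ≈ᴹ 1⊕ lowerRight T ·ᴹ withFirstRow (w ᵥ·ᴹ T)
  withFirstRow-·ᴹ w T T₀ zero    j = sym (1⊕-·ᴹ-first (lowerRight T) (withFirstRow (w ᵥ·ᴹ T)) j)
  withFirstRow-·ᴹ {n} w T T₀ (suc i) j = begin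
    (withFirstRow w ·ᴹ T) (suc i) j                        ≈⟨ +-congʳ (zeroˡ _) ⟩
    0# + (I F _ ·ᴹ lowerRows) i j                          ≈⟨ +-identityˡ _ ⟩
    (I F _ ·ᴹ lowerRows) i j                               ≈⟨ ·ᴹ-identityˡ lowerRows i j ⟩
    T (suc i) j                                            ≈⟨ rest j ⟨
    (lowerRight T ·ᴹ (λ l → withFirstRow _ (suc l))) i j
      ≈⟨ 1⊕-·ᴹ-rest (lowerRight T) (withFirstRow (w ᵥ·ᴹ T)) i j ⟨
    (1⊕ lowerRight T ·ᴹ withFirstRow (w ᵥ·ᴹ T)) (suc i) j  ∎
    where
    lowerRows = λ l → T (suc l)
    rest : ∀ j → (lowerRight T ·ᴹ (λ l → withFirstRow (w ᵥ·ᴹ T) (suc l))) i j ≈ T (suc i) j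
    rest zero    = trans (Σ-zero n λ l → zeroʳ _) (sym (T₀ i))
    rest (suc j) = ·ᴹ-identityʳ (lowerRight T) i j

  withFirstRow-cong : ∀ {n} {w w′ : Fin (suc n) → K F} → (∀ j → w j ≈ w′ j) → withFirstRow w ≈ᴹ withFirstRow w′
  withFirstRow-cong w≈w′ zero    j       = w≈w′ j
  withFirstRow-cong w≈w′ (suc i) zero    = refl
  withFirstRow-cong w≈w′ (suc i) (suc j) = refl

  H-inverse : ∀ {r} → Mat F (suc r) (suc r) → Mat F r r → Mat F (suc r) (suc r)
  H-inverse h B zero    zero    = 1#
  H-inverse h B zero    (suc j) = - ((λ l → h zero (suc l)) ᵥ·ᴹ B) j
  H-inverse h B (suc i) zero    = 0#
  H-inverse h B (suc i) (suc j) = B i j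

  InH-inverse : ∀ r (h : Mat F (suc r) (suc r)) → InH F r h →
    Σ[ h⁻¹ ∈ Mat F (suc r) (suc r) ]
      ZeroBelowCorner h⁻¹ × (h ·ᴹ h⁻¹ ≈ᴹ I F (suc r)) × (h⁻¹ ·ᴹ h ≈ᴹ I F (suc r))
  InH-inverse r h (h₀₀≈1 , h₀ , B , h′B≈I , Bh′≈I) =
      H-inverse h B , (λ _ → refl)
    , ≈I-byBlocks (h ·ᴹ h⁻¹)
        (trans (·ᴹ-column₀ h h⁻¹ (λ _ → refl) zero) (trans (*-identityʳ _) h₀₀≈1))
        right-first-row
        (ZeroBelowCorner-·ᴹ h h⁻¹ h₀ λ _ → refl)
        (≈ᴹ-trans (lowerRight-·ᴹ h h⁻¹ h₀) h′B≈I)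
    , ≈I-byBlocks (h⁻¹ ·ᴹ h)
        (trans (·ᴹ-column₀ h⁻¹ h h₀ zero) (trans (*-identityˡ _) h₀₀≈1))
        left-first-row
        (ZeroBelowCorner-·ᴹ h⁻¹ h (λ _ → refl) h₀)
        (≈ᴹ-trans (lowerRight-·ᴹ h⁻¹ h λ _ → refl) Bh′≈I)
    where
    h⁻¹ = H-inverse h B
    x : Mat F 1 r
    x _ l = h zero (suc l)
    right-first-row : ∀ j → (h ·ᴹ H-inverse h B) zero (suc j) ≈ 0#
    right-first-row j = begin
      h zero zero * - (x ·ᴹ B) zero j + (x ·ᴹ B) zero j ≈⟨ +-congʳ (trans (*-congʳ h₀₀≈1) (*-identityˡ _)) ⟩
      - (x ·ᴹ B) zero j + (x ·ᴹ B) zero j               ≈⟨ -‿inverseˡ _ ⟩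
      0#                                                 ∎
    left-first-row : ∀ j → (H-inverse h B ·ᴹ h) zero (suc j) ≈ 0#
    left-first-row j = begin
      1# * x zero j + ∑ r (λ l → - (x ·ᴹ B) zero l * h (suc l) (suc j))
        ≈⟨ +-cong (*-identityˡ _) (Σ-cong r λ l → sym (RingProperties.-‿distribˡ-* ring _ _)) ⟩
      x zero j + ∑ r (λ l → - ((x ·ᴹ B) zero l * h (suc l) (suc j)))
        ≈⟨ +-congˡ (-‿distrib-Σ r _) ⟩
      x zero j - (x ·ᴹ B ·ᴹ lowerRight h) zero j
        ≈⟨ +-congˡ (-‿cong (trans (·ᴹ-assoc x B (lowerRight h) zero j) (·ᴹ-congˡ x Bh′≈I zero j))) ⟩
      x zero j - (x ·ᴹ I F r) zero j                    ≈⟨ +-congˡ (-‿cong (·ᴹ-identityʳ x zero j)) ⟩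
      x zero j - x zero j                                ≈⟨ -‿inverseʳ _ ⟩
      0#                                                 ∎

  -- The Kronecker product t(h,g)

  module _ {m n : ℕ} where
    private
      q : Fin (m ℕ.* n) → Fin m
      q = quotient n
      r : Fin (m ℕ.* n) → Fin n
      r = remainder {m} n

    t-cong : ∀ {h h′ : Mat F m m} {g g′ : Mat F n n} → h ≈ᴹ h′ → g ≈ᴹ g′ → t F h g ≈ᴹ t F h′ g′
    t-cong h≈h′ g≈g′ a b = *-cong (h≈h′ _ _) (g≈g′ _ _)

    t-·ᴹ : ∀ (h h′ : Mat F m m) (g g′ : Mat F n n) → t F h g ·ᴹ t F h′ g′ ≈ᴹ t F (h ·ᴹ h′) (g ·ᴹ g′)
    t-·ᴹ h h′ g g′ a b = begin
      ∑ (m ℕ.* n) (λ l → h (q a) (q l) * g (r a) (r l) * (h′ (q l) (q b) * g′ (r l) (r b)))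
        ≈⟨ Σ-remQuot m n (λ i k → h (q a) i * g (r a) k * (h′ i (q b) * g′ k (r b))) ⟩
      ∑ m (λ i → ∑ n (λ k → h (q a) i * g (r a) k * (h′ i (q b) * g′ k (r b))))
        ≈⟨ Σ-cong m (λ i → Σ-cong n λ k → CommutativeSemigroupProperties.interchange *-commutativeSemigroup _ _ _ _) ⟩
      ∑ m (λ i → ∑ n (λ k → h (q a) i * h′ i (q b) * (g (r a) k * g′ k (r b))))
        ≈⟨ Σ-cong m (λ i → *-distribˡ-Σ n _ _) ⟨
      ∑ m (λ i → h (q a) i * h′ i (q b) * ∑ n (λ k → g (r a) k * g′ k (r b)))
        ≈⟨ *-distribʳ-Σ m _ _ ⟨
      (h ·ᴹ h′) (q a) (q b) * (g ·ᴹ g′) (r a) (r b) ∎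

    t-I : t F (I F m) (I F n) ≈ᴹ I F (m ℕ.* n)
    t-I a b with a ≟ᶠ b | q a ≟ᶠ q b | r a ≟ᶠ r b
    ... | yes ≡.refl | _ | _ =
      trans (*-cong (reflexive (I-diag m (q a) ≡.refl)) (reflexive (I-diag n (r a) ≡.refl)))
            (trans (*-identityˡ 1#) (reflexive (≡.sym (I-diag (m ℕ.* n) a ≡.refl))))
    ... | no a≢b | no qa≢qb | _ =
      trans (*-congʳ (reflexive (I-offdiag m qa≢qb))) (trans (zeroˡ _) (reflexive (≡.sym (I-offdiag (m ℕ.* n) a≢b))))
    ... | no a≢b | yes _ | no ra≢rb =
      trans (*-congˡ (reflexive (I-offdiag n ra≢rb))) (trans (zeroʳ _) (reflexive (≡.sym (I-offdiag (m ℕ.* n) a≢b))))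
    ... | no a≢b | yes qa≡qb | yes ra≡rb = contradiction
      (≡.trans (≡.sym (combine-remQuot {m} n a)) (≡.trans (≡.cong₂ combine qa≡qb ra≡rb) (combine-remQuot {m} n b)))
      a≢b

    t-inverse : ∀ (h h′ : Mat F m m) (g g′ : Mat F n n) → h ·ᴹ h′ ≈ᴹ I F m → g ·ᴹ g′ ≈ᴹ I F n →
      t F h g ·ᴹ t F h′ g′ ≈ᴹ I F (m ℕ.* n)
    t-inverse h h′ g g′ hh′≈I gg′≈I = ≈ᴹ-trans (t-·ᴹ h h′ g g′) (≈ᴹ-trans (t-cong hh′≈I gg′≈I) t-I)

  t-ZeroBelowCorner : ∀ {m′ n′} (h : Mat F (suc m′) (suc m′)) (g : Mat F (suc n′) (suc n′)) →
    ZeroBelowCorner h → ZeroBelowCorner g → ZeroBelowCorner (t F h g)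
  t-ZeroBelowCorner {m′} {n′} h g h₀ g₀ a =
    first-column (quotient (suc n′) (suc a)) (remainder {suc m′} (suc n′) (suc a))
                 (combine-remQuot {suc m′} (suc n′) (suc a))
    where
    first-column : ∀ i k → combine i k ≡ suc a → h i zero * g k zero ≈ 0#
    first-column zero    zero    ()
    first-column zero    (suc k) _ = trans (*-congˡ (g₀ k)) (zeroʳ _)
    first-column (suc i) k       _ = trans (*-congʳ (h₀ i)) (zeroˡ _)

  t-InH : ∀ m′ n′ (h : Mat F (suc m′) (suc m′)) → InH F m′ h → (g : Mat F (suc n′) (suc n′)) → InH F n′ g →
    InH F (n′ ℕ.+ m′ ℕ.* suc n′) (t F h g)
  t-InH m′ n′ h h∈H@(h₀₀≈1 , h₀ , _) g g∈H@(g₀₀≈1 , g₀ , _)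
    with InH-inverse m′ h h∈H | InH-inverse n′ g g∈H
  ... | h⁻¹ , h⁻¹₀ , hh⁻¹≈I , h⁻¹h≈I | g⁻¹ , g⁻¹₀ , gg⁻¹≈I , g⁻¹g≈I =
      trans (*-cong h₀₀≈1 g₀₀≈1) (*-identityˡ 1#)
    , t-ZeroBelowCorner h g h₀ g₀
    , InGL-lowerRight _ (t F h g) (t F h⁻¹ g⁻¹)
        (t-ZeroBelowCorner h g h₀ g₀) (t-ZeroBelowCorner h⁻¹ g⁻¹ h⁻¹₀ g⁻¹₀)
        (t-inverse h h⁻¹ g g⁻¹ hh⁻¹≈I gg⁻¹≈I) (t-inverse h⁻¹ h g⁻¹ g h⁻¹h≈I g⁻¹g≈I)

  -- Row-major vectorisation: vec M (combine i k) = M i k.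
  vec : ∀ {m n} → Mat F m n → Fin (m ℕ.* n) → K F
  vec {m} {n} M l = M (quotient n l) (remainder {m} n l)

  vec-t : ∀ {m n} (M : Mat F m n) (h : Mat F m m) (g : Mat F n n) →
    ∀ j → (vec M ᵥ·ᴹ t F h g) j ≈ vec (transpose F h ·ᴹ M ·ᴹ g) j
  vec-t {m} {n} M h g j = begin
    ∑ (m ℕ.* n) (λ l → vec M l * t F h g l j)            ≈⟨ Σ-remQuot m n (λ i k → M i k * (h i a * g k b)) ⟩
    ∑ m (λ i → ∑ n (λ k → M i k * (h i a * g k b)))
      ≈⟨ Σ-cong m (λ i → Σ-cong n λ k → trans (sym (*-assoc _ _ _)) (*-congʳ (*-comm _ _))) ⟩
    ∑ m (λ i → ∑ n (λ k → h i a * M i k * g k b))          ≈⟨ Σ-comm m n (λ i k → h i a * M i k * g k b) ⟩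
    ∑ n (λ k → ∑ m (λ i → h i a * M i k * g k b))
      ≈⟨ Σ-cong n (λ k → *-distribʳ-Σ m (g k b) (λ i → h i a * M i k)) ⟨
    (transpose F h ·ᴹ M ·ᴹ g) a b                         ∎
    where
    a = quotient n j
    b = remainder {m} n j

  u₁≈withFirstRow : ∀ m′ n′ (M : Mat F (suc m′) (suc n′)) → M zero zero ≈ 1# →
    u₁ F m′ n′ M ≈ᴹ withFirstRow (vec M)
  u₁≈withFirstRow m′ n′ M M₀₀≈1 zero    zero    = sym M₀₀≈1
  u₁≈withFirstRow m′ n′ M M₀₀≈1 zero    (suc j) = refl
  u₁≈withFirstRow m′ n′ M M₀₀≈1 (suc i) zero    = refl
  u₁≈withFirstRow m′ n′ M M₀₀≈1 (suc i) (suc j) = refl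

  u₁-·ᴹ-t : ∀ m′ n′ (h : Mat F (suc m′) (suc m′)) → InH F m′ h →
    (g : Mat F (suc n′) (suc n′)) → InH F n′ g → ∀ v → u₁ F m′ n′ (R F m′ n′ v) ·ᴹ t F h g
            ≈ᴹ 1⊕ lowerRight (t F h g) ·ᴹ u₁ F m′ n′ (transpose F h ·ᴹ R F m′ n′ v ·ᴹ g)
  u₁-·ᴹ-t m′ n′ h h∈H g g∈H v i j = begin
    (u₁ F m′ n′ Rv ·ᴹ T) i j                     ≈⟨ ·ᴹ-congʳ T (u₁≈withFirstRow m′ n′ Rv refl) i j ⟩
    (withFirstRow (vec Rv) ·ᴹ T) i j             ≈⟨ withFirstRow-·ᴹ (vec Rv) T T₀ i j ⟩
    (1⊕ lowerRight T ·ᴹ withFirstRow (vec Rv ᵥ·ᴹ T)) i j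
      ≈⟨ ·ᴹ-congˡ (1⊕ lowerRight T) (withFirstRow-cong (vec-t Rv h g)) i j ⟩
    (1⊕ lowerRight T ·ᴹ withFirstRow (vec S)) i j
      ≈⟨ ·ᴹ-congˡ (1⊕ lowerRight T) (u₁≈withFirstRow m′ n′ S S₀₀≈1) i j ⟨
    (1⊕ lowerRight T ·ᴹ u₁ F m′ n′ S) i j        ∎
    where
    Rv = R F m′ n′ v
    S = transpose F h ·ᴹ Rv ·ᴹ g
    T = t F h g
    T∈H = t-InH m′ n′ h h∈H g g∈H
    T₀ = proj₁ (proj₂ T∈H)
    -- S₀₀ is entry 0 of vec S = vec R · t(h,g), that is R₀₀ t₀₀ = 1.
    S₀₀≈1 : S zero zero ≈ 1#
    S₀₀≈1 = trans (sym (vec-t Rv h g zero)) (trans (·ᴹ-column₀ (λ (_ : Fin 1) → vec Rv) T T₀ zero)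
                  (trans (*-identityˡ _) (proj₁ T∈H)))

  -- The permutation matrix w₁

  w₁-inject₁ : ∀ N′ (j : Fin N′) l → w₁ F N′ (inject₁ j) l ≡ I F (suc N′) (suc j) l
  w₁-inject₁ N′ j l with toℕ l ℕ.≟ suc (toℕ (inject₁ j)) | toℕ (inject₁ j) ℕ.≟ N′ | toℕ l ℕ.≟ 0
  ... | yes l≡1+j | _ | _ =
    ≡.sym (I-diag (suc N′) (suc j) (≡.sym (toℕ-injective (≡.trans l≡1+j (≡.cong suc (toℕ-inject₁ j))))))
  ... | no _     | yes j≡N′ | _ = contradiction (≡.sym j≡N′) (toℕ-inject₁-≢ j)
  ... | no l≢1+j | no _     | _ =
    ≡.sym (I-offdiag (suc N′) λ 1+j≡l →
      l≢1+j (≡.trans (≡.cong toℕ (≡.sym 1+j≡l)) (≡.cong suc (≡.sym (toℕ-inject₁ j)))))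

  w₁-fromℕ : ∀ N′ l → w₁ F N′ (fromℕ N′) l ≡ I F (suc N′) zero l
  w₁-fromℕ N′ l with toℕ l ℕ.≟ suc (toℕ (fromℕ N′)) | toℕ (fromℕ N′) ℕ.≟ N′ | toℕ l ℕ.≟ 0
  ... | yes l≡1+N′ | _ | _ = contradiction (≡.trans l≡1+N′ (≡.cong suc (toℕ-fromℕ N′))) (<⇒≢ (toℕ<n l))
  ... | no _ | no N′≢N′ | _      = contradiction (toℕ-fromℕ N′) N′≢N′
  ... | no _ | yes _    | yes l≡0 = ≡.sym (I-diag (suc N′) zero (≡.sym (toℕ-injective l≡0)))
  ... | no _ | yes _    | no l≢0  = ≡.sym (I-offdiag (suc N′) λ 0≡l → l≢0 (≡.cong toℕ (≡.sym 0≡l)))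

  w₁-row : ∀ N′ (i l : Fin (suc N′)) → w₁ F N′ i l ≡ I F (suc N′) (rotate N′ i) l
  w₁-row N′ i l with inject₁-or-fromℕ N′ i
  ... | inj₁ (j , ≡.refl) rewrite rotate-inject₁ N′ j = w₁-inject₁ N′ j l
  ... | inj₂ ≡.refl       rewrite rotate-fromℕ N′     = w₁-fromℕ N′ l

  w₁-·ᴹ : ∀ N′ {p} (X : Mat F (suc N′) p) → w₁ F N′ ·ᴹ X ≈ᴹ (λ i → X (rotate N′ i))
  w₁-·ᴹ N′ X i j =
    trans (Σ-cong (suc N′) λ l → *-congʳ {X l j} (reflexive (w₁-row N′ i l))) (·ᴹ-identityˡ X (rotate N′ i) j)

  -- rotated D = w₁ D w₁⁻¹
  rotated : ∀ {N′} → Mat F (suc N′) (suc N′) → Mat F (suc N′) (suc N′)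
  rotated {N′} D i j = D (rotate N′ i) (rotate N′ j)

  w₁-·ᴹ-rotated : ∀ N′ {p} (D : Mat F (suc N′) (suc N′)) (Y : Mat F (suc N′) p) →
    w₁ F N′ ·ᴹ (D ·ᴹ Y) ≈ᴹ rotated D ·ᴹ (w₁ F N′ ·ᴹ Y)
  w₁-·ᴹ-rotated N′ D Y i j = begin
    (w₁ F N′ ·ᴹ (D ·ᴹ Y)) i j                                        ≈⟨ w₁-·ᴹ N′ (D ·ᴹ Y) i j ⟩
    ∑ (suc N′) (λ l → D (rotate N′ i) l * Y l j)
      ≈⟨ Σ-rotate N′ (λ l → D (rotate N′ i) l * Y l j) ⟨
    ∑ (suc N′) (λ l → D (rotate N′ i) (rotate N′ l) * Y (rotate N′ l) j)
      ≈⟨ Σ-cong (suc N′) (λ l → *-congˡ {D (rotate N′ i) (rotate N′ l)} (w₁-·ᴹ N′ Y l j)) ⟨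
    (rotated D ·ᴹ (w₁ F N′ ·ᴹ Y)) i j                                 ∎

  rotated-1⊕-InP : ∀ N′ {A : Mat F N′ N′} → InGL F N′ A → InP F N′ (rotated (1⊕ A))
  rotated-1⊕-InP N′ {A} A∈GL =
      (λ j → reflexive (≡.cong₂ (1⊕ A) (rotate-fromℕ N′) (rotate-inject₁ N′ j)))
    , InGL-resp N′ A (λ i j → reflexive (≡.cong₂ (1⊕ A) (rotate-inject₁ N′ i) (rotate-inject₁ N′ j))) A∈GL
    , λ corner≈0 → 0≉1 (sym (trans (reflexive (≡.cong₂ (1⊕ A) (≡.sym last↦0) (≡.sym last↦0))) corner≈0))
    where
    last↦0 = rotate-fromℕ N′

  sameCoset-w₁ : ∀ N′ {A : Mat F N′ N′} {x : Mat F (suc N′) (suc N′)} (X Y : Mat F (suc N′) (suc N′)) →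
    InGL F N′ A → x ≈ᴹ w₁ F N′ ·ᴹ X → X ≈ᴹ 1⊕ A ·ᴹ Y → SameCoset F N′ x (w₁ F N′ ·ᴹ Y)
  sameCoset-w₁ N′ {A} {x} X Y A∈GL@(B , AB≈I , BA≈I) x≈w₁X X≈AY =
    sameCoset N′ (rotated (1⊕ A)) (rotated (1⊕ B)) (rotated-1⊕-InP N′ A∈GL) (rotated-1⊕-InP N′ (A , BA≈I , AB≈I))
      (≈ᴹ-trans x≈w₁X (≈ᴹ-trans (·ᴹ-congˡ (w₁ F N′) X≈AY) (w₁-·ᴹ-rotated N′ (1⊕ A) Y)))
      (≈ᴹ-trans (·ᴹ-congˡ (w₁ F N′) Y≈BX)
        (≈ᴹ-trans (w₁-·ᴹ-rotated N′ (1⊕ B) X) (·ᴹ-congˡ (rotated (1⊕ B)) (≈ᴹ-sym x≈w₁X))))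
    where
    Y≈BX : Y ≈ᴹ 1⊕ B ·ᴹ X
    Y≈BX = ≈ᴹ-sym (≈ᴹ-trans (·ᴹ-congˡ (1⊕ B) X≈AY) (≈ᴹ-trans (≈ᴹ-sym (·ᴹ-assoc (1⊕ B) (1⊕ A) Y))
             (≈ᴹ-trans (·ᴹ-congʳ Y (1⊕-inverse N′ BA≈I)) (·ᴹ-identityˡ Y))))

open import Data.Nat using (_+_; _*_)

lemma2p2 : ∀ {c ℓ : Level} (F : Field c ℓ) (m' n' : ℕ)
  → (h : Mat F (suc m') (suc m')) → InH F m' h
  → (g : Mat F (suc n') (suc n')) → InH F n' g
  → (v : Fin (n' + m' * suc n') → K F)
  → SameCoset F (n' + m' * suc n')
      (_·_ F (_·_ F (w₁ F (n' + m' * suc n')) (u₁ F m' n' (R F m' n' v))) (t F h g))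
      (_·_ F (w₁ F (n' + m' * suc n'))
             (u₁ F m' n' (_·_ F (_·_ F (transpose F h) (R F m' n' v)) g)))
lemma2p2 F m' n' h h∈H g g∈H v =
  sameCoset-w₁ F N′ {A = lowerRight F T} (_·_ F u₁R T) (u₁ F m' n' S)
    (proj₂ (proj₂ (t-InH F m' n' h h∈H g g∈H)))
    (·ᴹ-assoc F (w₁ F N′) u₁R T)
    (u₁-·ᴹ-t F m' n' h h∈H g g∈H v)
  where
  N′ = n' + m' * suc n'
  T = t F h g
  u₁R = u₁ F m' n' (R F m' n' v)
  S = _·_ F (_·_ F (transpose F h) (R F m' n' v)) g
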